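{- Let $n\geq 2$, $C=\mathbb{Z}/n\mathbb{Z}$, $a\in C$, and let $H_1,H_2$ be the sets of top rows and bottom rows of colored Frobenius partitions associated to diagonally $a$-colored Young diagrams (defined in the context). Then, with $q=\prod_{c\in C}q_c$, (1) \[ \sum_{d\geq 0}\sum_{\underline{k}} P_{H_1}(\underline{k},d)\,z^d\, \underline{q}^{\underline{k}}= \prod_{k=0}^\infty\prod_{i=0}^{n-1}\bigl(1+z\,q_{0+a}q_{1+a}\cdots q_{i+a}\,q^k\bigr)\;; \] (2) \[ \sum_{d\geq 0}\sum_{\underline{k}} P_{H_2}(\underline{k},d)\,z^{ -d}\, \underline{q}^{\underline{k}}= \prod_{k=0}^\infty\prod_{i=0}^{n-1}\bigl(1+z^{ -1}q_{i+1+a}\cdots q_{n-1+a}\,q^k\bigr)\;, \] where for $i=n-1$ the product $q_{i+1+a}\cdots q_{n-1+a}$ is empty and equals $1$.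
   Context: Boxes of a Young diagram $Y$ are indexed by pairs $(i,j)$ of positive integers (row $i$, column $j$); the diagonal $a$-coloring gives box $(i,j)$ the color $\mathrm{res}(i,j)=a-i+j+n\mathbb{Z}\in C$. Indices of $q_c$ are taken in $C$. Let $d$ be the number of boxes $(t,t)$ of $Y$ on the main diagonal. For $1\leq t\leq d$ define $\underline{f}_t,\underline{g}_t\in\mathbb{Z}_{\geq0}^C$ by $f_{t,c}=\#\{j\geq t:(t,j)\in Y,\ \mathrm{res}(t,j)=c\}$ and $g_{t,c}=\#\{i> t:(i,t)\in Y,\ \mathrm{res}(i,t)=c\}$. Then $H_1$ is the set of all tuples $(\underline{f}_1,\dots,\underline{f}_d)$ and $H_2$ the set of all tuples $(\underline{g}_1,\dots,\underline{g}_d)$ obtained in this way from some Young diagram $Y$ (including the empty tuple from the empty diagram). For a set $H$ of tuples of vectors in $\mathbb{Z}_{\geq0}^C$, $P_H(\underline{k},d)$ is the number of $d$-tuples in $H$ whose componentwise sum is $\underline{k}$, and $\underline{q}^{\underline{k}}=\prod_c q_c^{k_c}$. -}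

module Defs where

open import Data.Nat using (ℕ; zero; suc; _+_; _*_; _∸_; _≤_; _<_; _≥_; _≤ᵇ_; NonZero)
open import Data.Nat as ℕ using ()
open import Data.Integer as ℤ using (ℤ; +_)
open import Data.Integer.DivMod using (_%ℕ_)
open import Data.Fin using (Fin; toℕ)
open import Data.Bool using (if_then_else_)
open import Data.List using (List; []; _∷_; length; filter; map; upTo; foldr)
open import Data.List.Relation.Unary.Linked using (Linked)
open import Data.List.Relation.Unary.All using (All)
open import Data.List.Relation.Unary.Unique.Propositional using (Unique)
open import Data.List.Membership.Propositional using (_∈_)
open import Data.Vec using (Vec; tabulate; zipWith; replicate)
open import Data.Product using (Σ; _×_; _,_; ∃)
open import Data.Sum using (_⊎_)
open import Function.Bundles using (_⇔_)
open import Relation.Binary.PropositionalEquality using (_≡_)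
open import Data.Nat using (_≟_)

HasCard : {A : Set} → (A → Set) → ℕ → Set
HasCard {A} P N = Σ (List A) λ L → Unique L × (∀ x → (x ∈ L) ⇔ P x) × length L ≡ N

-- A Young diagram: list of row lengths (row 1 first), all positive, weakly decreasing.
YoungDiagram : List ℕ → Set
YoungDiagram λs = All (λ r → 1 ≤ r) λs × Linked _≥_ λs

-- length of row i (1-indexed); 0 if beyond the diagram
rowLen : List ℕ → ℕ → ℕ
rowLen [] _ = 0
rowLen (r ∷ rs) zero = 0
rowLen (r ∷ rs) (suc zero) = r
rowLen (r ∷ rs) (suc (suc i)) = rowLen rs (suc i)

colLen : List ℕ → ℕ → ℕ
colLen λs t = length (filter (λ r → t ℕ.≤? r) λs)

range : ℕ → ℕ → List ℕ
range s m = map (λ x → s + x) (upTo (suc m ∸ s))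

res : (n : ℕ) .{{_ : NonZero n}} → Fin n → ℕ → ℕ → ℕ
res n a i j = ((+ toℕ a ℤ.- + i) ℤ.+ + j) %ℕ n

count : (ℕ → ℕ) → ℕ → List ℕ → ℕ
count f c xs = length (filter (λ x → f x ≟ c) xs)

diagLen : List ℕ → ℕ
diagLen λs = length (filter (λ t → t ℕ.≤? rowLen λs t) (range 1 (length λs)))

fvec : (n : ℕ) .{{_ : NonZero n}} → Fin n → List ℕ → ℕ → Vec ℕ n
fvec n a λs t = tabulate λ c → count (λ j → res n a t j) (toℕ c) (range t (rowLen λs t))

gvec : (n : ℕ) .{{_ : NonZero n}} → Fin n → List ℕ → ℕ → Vec ℕ n
gvec n a λs t = tabulate λ c → count (λ i → res n a i t) (toℕ c) (range (suc t) (colLen λs t))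

topRow : (n : ℕ) .{{_ : NonZero n}} → Fin n → List ℕ → List (Vec ℕ n)
topRow n a λs = map (fvec n a λs) (range 1 (diagLen λs))

bottomRow : (n : ℕ) .{{_ : NonZero n}} → Fin n → List ℕ → List (Vec ℕ n)
bottomRow n a λs = map (gvec n a λs) (range 1 (diagLen λs))

InH1 : (n : ℕ) .{{_ : NonZero n}} → Fin n → List (Vec ℕ n) → Set
InH1 n a T = ∃ λ λs → YoungDiagram λs × topRow n a λs ≡ T

InH2 : (n : ℕ) .{{_ : NonZero n}} → Fin n → List (Vec ℕ n) → Set
InH2 n a T = ∃ λ λs → YoungDiagram λs × bottomRow n a λs ≡ T

vsum : {n : ℕ} → List (Vec ℕ n) → Vec ℕ n
vsum {n} = foldr (zipWith _+_) (replicate n 0)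

-- d-tuples in H with componentwise sum k (P_H(k,d) is the cardinality of this set)
PH : {n : ℕ} → (List (Vec ℕ n) → Set) → ℕ → Vec ℕ n → List (Vec ℕ n) → Set
PH H d k T = H T × length T ≡ d × vsum T ≡ k

-- Factors are indexed by pairs (k,i), k ∈ ℕ, i ∈ {0..n-1}.
-- Expanding ∏ (1 + z^{±1} m_{k,i}), the coefficient of z^{±d} q^k is the number
-- of finite sets of d distinct factors whose monomials multiply to q^k.
-- Finite sets of factors are represented as strictly increasing lists (lex order).
_<ₚ_ : {n : ℕ} → ℕ × Fin n → ℕ × Fin n → Set
(k , i) <ₚ (k' , i') = k < k' ⊎ (k ≡ k' × toℕ i < toℕ i')

-- exponent vector of q_{a} q_{a+1} ... q_{a+i} q^k   (factor of (1))
expo1 : (n : ℕ) .{{_ : NonZero n}} → Fin n → ℕ × Fin n → Vec ℕ n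
expo1 n a (k , i) = tabulate λ c →
  k + (if ((+ toℕ c ℤ.- + toℕ a) %ℕ n) ≤ᵇ toℕ i then 1 else 0)

-- exponent vector of q_{a+i+1} ... q_{a+n-1} q^k   (factor of (2))
expo2 : (n : ℕ) .{{_ : NonZero n}} → Fin n → ℕ × Fin n → Vec ℕ n
expo2 n a (k , i) = tabulate λ c →
  k + (if ((+ toℕ c ℤ.- + toℕ a) %ℕ n) ≤ᵇ toℕ i then 0 else 1)

Coeff : {n : ℕ} → (ℕ × Fin n → Vec ℕ n) → ℕ → Vec ℕ n → List (ℕ × Fin n) → Set
Coeff e d k S = Linked _<ₚ_ S × length S ≡ d × vsum (map e S) ≡ k

module Submission where

-- (1) Frobenius coordinates: the arm (leg) lengths along the diagonal of a Young diagram
--     form a strictly decreasing list, and every such list arises (add hooks).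
-- (2) Counting residues: the row piece with arm m has the colour vector of the factor
--     (m div n, m mod n); the column piece with leg M that of (M div n, n-1-(M mod n)).
-- (3) Numbering the factors (k', i) by i + k'·n makes sets of factors into finite sets
--     of naturals; relabelling by the involution reversing each block of n and sorting
--     matches them with the decreasing lists of (1)-(2).  Finiteness is by enumeration.

open import Defs
open import Data.Bool using (Bool; true; false; if_then_else_; not)
open import Data.Empty using (⊥-elim)
open import Data.Fin using (Fin; toℕ; opposite)
open import Data.Fin.Properties using (toℕ<n; toℕ-fromℕ<; toℕ-injective; opposite-prop; opposite-involutive)
open import Data.Integer as ℤ using (ℤ; -[1+_])
import Data.Integer.Properties as ℤₚ
open import Data.Integer.DivMod using (_%ℕ_)
open import Data.Integer.Tactic.RingSolver using (solve-∀)
open import Data.List using (List; []; _∷_; [_]; length; map; filter; _++_; replicate; deduplicate; concatMap; upTo; applyUpTo)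
open import Data.List.Properties
  using (length-map; length-++; length-replicate; map-∘; map-cong; map-id; map-upTo; map-applyUpTo; map-injective;
         filter-accept; filter-reject; filter-++; upTo-∷ʳ)
import Data.List.Properties as Listₚ
open import Data.List.Membership.Propositional using (_∈_)
open import Data.List.Membership.Propositional.Properties
  using (∈-map⁺; ∈-map⁻; ∈-filter⁺; ∈-filter⁻; ∈-deduplicate⁺; ∈-deduplicate⁻; ∈-concatMap⁺; ∈-upTo⁺)
open import Data.List.Relation.Unary.Any as Any using (here; there)
open import Data.List.Relation.Unary.All as All using (All; []; _∷_)
import Data.List.Relation.Unary.All.Properties as Allₚ
import Data.List.Relation.Unary.AllPairs as AllPairs
open import Data.List.Relation.Unary.Linked as Linked using (Linked; []; [-]; _∷_)
import Data.List.Relation.Unary.Linked.Properties as Linkedₚ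
open import Data.List.Relation.Unary.Unique.Propositional using (Unique; []; _∷_)
import Data.List.Relation.Unary.Unique.Propositional.Properties as Uniqueₚ
import Data.List.Relation.Unary.Unique.DecPropositional.Properties as DecUniqueₚ
open import Data.List.Relation.Binary.Permutation.Propositional as Perm using (_↭_; ↭-sym; ↭-trans; ↭⇒↭ₛ)
import Data.List.Relation.Binary.Permutation.Propositional.Properties as Permₚ
import Data.List.Relation.Binary.Permutation.Setoid.Properties as PermSetoidₚ
open import Data.List.Relation.Binary.Pointwise using (Pointwise-≡⇒≡)
open import Data.List.Relation.Unary.Sorted.TotalOrder.Properties using (↗↭↗⇒≋)
import Data.List.Sort as Sort
open import Data.Nat as ℕ
  using (ℕ; zero; suc; _+_; _*_; _∸_; _≤_; _<_; _≥_; _>_; _≤?_; _<?_; _≟_; _≤ᵇ_; z≤n; s≤s; NonZero; _%_; _/_)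
open import Data.Nat.Properties
open import Data.Nat.DivMod
open import Data.Nat.Divisibility using (n∣m*n)
open import Data.Product using (Σ; ∃; _×_; _,_; proj₁; proj₂)
open import Data.Sum using (_⊎_; inj₁; inj₂; [_,_]′)
open import Data.Unit using (tt)
open import Data.Vec as Vec using (Vec; tabulate; lookup)
import Data.Vec.Properties as Vecₚ
open import Function using (_∘_; id)
open import Function.Bundles using (_⇔_; mk⇔; Equivalence)
open import Relation.Binary.Definitions using (DecidableEquality; tri<; tri≈; tri>)
open import Relation.Binary.PropositionalEquality
  using (_≡_; _≢_; refl; sym; trans; cong; cong₂; subst; subst₂; setoid; module ≡-Reasoning)
import Relation.Binary.Construct.Flip.EqAndOrd as Flip
open import Relation.Nullary using (Dec; yes; no; does; ¬_; ¬?)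
open import Relation.Nullary.Decidable using (_×-dec_)
open import Relation.Unary using (Decidable)


hasCard-image : {A B : Set} {Q : A → Set} {P : B → Set} (f : A → B) →
  (∀ {x y} → Q x → Q y → f x ≡ f y → x ≡ y) →
  (∀ y → P y ⇔ (∃ λ x → Q x × f x ≡ y)) →
  ∀ {N} → HasCard Q N → HasCard P N
hasCard-image {Q = Q} {P} f inj onto (L , uniq , mem , len) =
  map f L , uniqueImage inQ uniq , (λ y → mk⇔ (toP y) (fromP y)) , trans (length-map f L) len
  where
  inQ : All Q L
  inQ = All.tabulate (Equivalence.to (mem _))

  uniqueImage : ∀ {xs} → All Q xs → Unique xs → Unique (map f xs)
  uniqueImage [] [] = []
  uniqueImage {x ∷ _} (qx ∷ qxs) (x∉ ∷ u) = separated qxs x∉ ∷ uniqueImage qxs u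
    where
    separated : ∀ {ys} → All Q ys → All (x ≢_) ys → All (f x ≢_) (map f ys)
    separated [] [] = []
    separated (qy ∷ qys) (x≢y ∷ x≢ys) = (λ e → x≢y (inj qx qy e)) ∷ separated qys x≢ys

  toP : ∀ y → y ∈ map f L → P y
  toP y y∈ with ∈-map⁻ f y∈
  ... | x , x∈L , refl = Equivalence.from (onto y) (x , Equivalence.to (mem x) x∈L , refl)

  fromP : ∀ y → P y → y ∈ map f L
  fromP y py with Equivalence.to (onto y) py
  ... | x , qx , refl = ∈-map⁺ f (Equivalence.from (mem x) qx)

hasCard-bijection : {A B : Set} {Q : A → Set} {P : B → Set} (f : A → B) (g : B → A) →
  (∀ {x} → Q x → P (f x)) → (∀ {y} → P y → Q (g y)) →
  (∀ {x} → Q x → g (f x) ≡ x) → (∀ {y} → P y → f (g y) ≡ y) →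
  ∀ {N} → HasCard Q N → HasCard P N
hasCard-bijection {Q = Q} f g QP PQ gf fg =
  hasCard-image f inj (λ y → mk⇔ (λ py → g y , PQ py , fg py) (λ { (x , qx , refl) → QP qx }))
  where
  inj : ∀ {x y} → Q x → Q y → f x ≡ f y → x ≡ y
  inj {x} {y} qx qy e = trans (sym (gf qx)) (trans (cong g e) (gf qy))

hasCard-enumerate : {A : Set} → DecidableEquality A → {P : A → Set} → Decidable P →
  (L : List A) → (∀ x → P x → x ∈ L) → ∃ (HasCard P)
hasCard-enumerate _≟ᴬ_ P? L cover =
  length members , members , DecUniqueₚ.deduplicate-! _≟ᴬ_ (filter P? L) ,
  (λ x → mk⇔ (λ x∈ → proj₂ (∈-filter⁻ P? {xs = L} (∈-deduplicate⁻ _≟ᴬ_ (filter P? L) x∈)))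
             (λ px → ∈-deduplicate⁺ _≟ᴬ_ {xs = filter P? L} (∈-filter⁺ P? (cover x px) px))) , refl
  where
  members = deduplicate _≟ᴬ_ (filter P? L)

listsOver : {A : Set} → List A → ℕ → List (List A)
listsOver F zero = [] ∷ []
listsOver F (suc d) = concatMap (λ x → map (x ∷_) (listsOver F d)) F

∈-listsOver : {A : Set} {F S : List A} → All (_∈ F) S → S ∈ listsOver F (length S)
∈-listsOver [] = here refl
∈-listsOver {F = F} {x ∷ S} (x∈F ∷ S⊆F) =
  ∈-concatMap⁺ (λ y → map (y ∷_) (listsOver F (length S))) (Any.map (λ { refl → ∈-map⁺ (x ∷_) (∈-listsOver S⊆F) }) x∈F)


-- Finite sets of naturals are represented by strictly increasing or strictly
-- decreasing lists; sorting converts between the two after relabelling.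
Increasing Decreasing : List ℕ → Set
Increasing = Linked _<_
Decreasing = Linked _>_

module Asc = Sort ≤-decTotalOrder
module Desc = Sort (Flip.decTotalOrder ≤-decTotalOrder)

increasing⇒unique : ∀ {xs} → Increasing xs → Unique xs
increasing⇒unique inc = AllPairs.map <⇒≢ (Linkedₚ.Linked⇒AllPairs <-trans inc)

decreasing⇒unique : ∀ {xs} → Decreasing xs → Unique xs
decreasing⇒unique dec = AllPairs.map >⇒≢ (Linkedₚ.Linked⇒AllPairs (λ p q → <-trans q p) dec)

unique-↭ : ∀ {xs ys : List ℕ} → Unique xs → xs ↭ ys → Unique ys
unique-↭ u p = PermSetoidₚ.Unique-resp-↭ (setoid ℕ) (↭⇒↭ₛ p) u

sortAsc-increasing : ∀ {xs} → Unique xs → Increasing (Asc.sort xs)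
sortAsc-increasing {xs} u = strict (Asc.sort-↗ xs) (unique-↭ u (↭-sym (Asc.sort-↭ xs)))
  where
  strict : ∀ {ys} → Linked _≤_ ys → Unique ys → Increasing ys
  strict [] _ = []
  strict [-] _ = [-]
  strict (x≤y ∷ l) ((x≢y ∷ _) ∷ u) = ≤∧≢⇒< x≤y x≢y ∷ strict l u

sortDesc-decreasing : ∀ {xs} → Unique xs → Decreasing (Desc.sort xs)
sortDesc-decreasing {xs} u = strict (Desc.sort-↗ xs) (unique-↭ u (↭-sym (Desc.sort-↭ xs)))
  where
  strict : ∀ {ys} → Linked (λ x y → y ≤ x) ys → Unique ys → Decreasing ys
  strict [] _ = []
  strict [-] _ = [-]
  strict (y≤x ∷ l) ((x≢y ∷ _) ∷ u) = ≤∧≢⇒< y≤x (x≢y ∘ sym) ∷ strict l u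

increasing-↭ : ∀ {xs ys} → Increasing xs → Increasing ys → xs ↭ ys → xs ≡ ys
increasing-↭ ixs iys p =
  Pointwise-≡⇒≡ (↗↭↗⇒≋ ≤-totalOrder (Linked.map <⇒≤ ixs) (Linked.map <⇒≤ iys) (↭⇒↭ₛ p))

decreasing-↭ : ∀ {xs ys} → Decreasing xs → Decreasing ys → xs ↭ ys → xs ≡ ys
decreasing-↭ dxs dys p =
  Pointwise-≡⇒≡ (↗↭↗⇒≋ (Flip.totalOrder ≤-totalOrder) (Linked.map <⇒≤ dxs) (Linked.map <⇒≤ dys) (↭⇒↭ₛ p))

vsum-↭ : ∀ {n} {xs ys : List (Vec ℕ n)} → xs ↭ ys → vsum xs ≡ vsum ys
vsum-↭ Perm.refl = refl
vsum-↭ (Perm.prep x p) = cong (Vec.zipWith _+_ x) (vsum-↭ p)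
vsum-↭ (Perm.swap x y p) = trans (leftComm x y _) (cong (λ v → Vec.zipWith _+_ y (Vec.zipWith _+_ x v)) (vsum-↭ p))
  where
  open ≡-Reasoning
  leftComm : ∀ {n} (u v w : Vec ℕ n) → Vec.zipWith _+_ u (Vec.zipWith _+_ v w) ≡ Vec.zipWith _+_ v (Vec.zipWith _+_ u w)
  leftComm u v w = begin
    Vec.zipWith _+_ u (Vec.zipWith _+_ v w) ≡⟨ sym (Vecₚ.zipWith-assoc +-assoc u v w) ⟩
    Vec.zipWith _+_ (Vec.zipWith _+_ u v) w ≡⟨ cong (λ s → Vec.zipWith _+_ s w) (Vecₚ.zipWith-comm +-comm u v) ⟩
    Vec.zipWith _+_ (Vec.zipWith _+_ v u) w ≡⟨ Vecₚ.zipWith-assoc +-assoc v u w ⟩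
    Vec.zipWith _+_ v (Vec.zipWith _+_ u w) ∎
vsum-↭ (Perm.trans p q) = trans (vsum-↭ p) (vsum-↭ q)

IncrSet DecrSet : ∀ {n} → (ℕ → Vec ℕ n) → ℕ → Vec ℕ n → List ℕ → Set
IncrSet E d k U = Increasing U × length U ≡ d × vsum (map E U) ≡ k
DecrSet E d k W = Decreasing W × length W ≡ d × vsum (map E W) ≡ k

hasCard-relabel : ∀ {n} (E : ℕ → Vec ℕ n) (σ : ℕ → ℕ) → (∀ m → σ (σ m) ≡ m) →
  ∀ d k {N} → HasCard (IncrSet E d k) N → HasCard (DecrSet (E ∘ σ) d k) N
hasCard-relabel E σ σσ d k =
  hasCard-bijection (Desc.sort ∘ map σ) (Asc.sort ∘ map σ) toDecr toIncr backIncr backDecr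
  where
  σσ-list : ∀ xs → map σ (map σ xs) ≡ xs
  σσ-list xs = trans (sym (map-∘ xs)) (trans (map-cong σσ xs) (map-id xs))

  unique-relabel : ∀ {xs} → Unique xs → Unique (map σ xs)
  unique-relabel = Uniqueₚ.map⁺ (λ {x} {y} e → trans (sym (σσ x)) (trans (cong σ e) (σσ y)))

  weight-relabel : ∀ F xs → vsum (map (F ∘ σ) (map σ xs)) ≡ vsum (map F xs)
  weight-relabel F xs = cong vsum (trans (map-∘ (map σ xs)) (cong (map F) (σσ-list xs)))

  decreasing-relabel : ∀ {U} → Increasing U → Decreasing (Desc.sort (map σ U))
  decreasing-relabel inc = sortDesc-decreasing (unique-relabel (increasing⇒unique inc))

  increasing-relabel : ∀ {W} → Decreasing W → Increasing (Asc.sort (map σ W))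
  increasing-relabel dec = sortAsc-increasing (unique-relabel (decreasing⇒unique dec))

  toDecr : ∀ {U} → IncrSet E d k U → DecrSet (E ∘ σ) d k (Desc.sort (map σ U))
  toDecr {U} (inc , len , wt) =
    decreasing-relabel inc ,
    trans (Permₚ.↭-length (Desc.sort-↭ _)) (trans (length-map σ U) len) ,
    trans (vsum-↭ (Permₚ.map⁺ (E ∘ σ) (Desc.sort-↭ _))) (trans (weight-relabel E U) wt)

  toIncr : ∀ {W} → DecrSet (E ∘ σ) d k W → IncrSet E d k (Asc.sort (map σ W))
  toIncr {W} (dec , len , wt) =
    increasing-relabel dec ,
    trans (Permₚ.↭-length (Asc.sort-↭ _)) (trans (length-map σ W) len) ,
    trans (vsum-↭ (Permₚ.map⁺ E (Asc.sort-↭ _))) (trans (sym (cong vsum (map-∘ W))) wt)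

  backIncr : ∀ {U} → IncrSet E d k U → Asc.sort (map σ (Desc.sort (map σ U))) ≡ U
  backIncr {U} (inc , _) = increasing-↭ (increasing-relabel (decreasing-relabel inc)) inc
    (↭-trans (Asc.sort-↭ _) (subst (map σ (Desc.sort (map σ U)) ↭_) (σσ-list U) (Permₚ.map⁺ σ (Desc.sort-↭ _))))

  backDecr : ∀ {W} → DecrSet (E ∘ σ) d k W → Desc.sort (map σ (Asc.sort (map σ W))) ≡ W
  backDecr {W} (dec , _) = decreasing-↭ (decreasing-relabel (increasing-relabel dec)) dec
    (↭-trans (Desc.sort-↭ _) (subst (map σ (Asc.sort (map σ W)) ↭_) (σσ-list W) (Permₚ.map⁺ σ (Asc.sort-↭ _))))

lookup-weight≤ : ∀ {n} (E : ℕ → Vec ℕ n) (c : Fin n) {m} xs → m ∈ xs →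
  lookup (E m) c ≤ lookup (vsum (map E xs)) c
lookup-weight≤ E c (x ∷ xs) m∈ rewrite Vecₚ.lookup-zipWith _+_ c (E x) (vsum (map E xs)) with m∈
... | here refl = m≤m+n _ _
... | there m∈xs = ≤-trans (lookup-weight≤ E c xs m∈xs) (m≤n+m _ _)

hasCard-incrSet : ∀ {n} (E : ℕ → Vec ℕ n) (c : Fin n) (B : ℕ → ℕ) →
  (∀ m K → lookup (E m) c ≤ K → m < B K) → ∀ d k → ∃ (HasCard (IncrSet E d k))
hasCard-incrSet E c B bounded d k =
  hasCard-enumerate (Listₚ.≡-dec _≟_) incrSet? (listsOver (upTo (B (lookup k c))) d) cover
  where
  incrSet? : Decidable (IncrSet E d k)
  incrSet? U = Linked.linked? _<?_ U ×-dec (length U ≟ d ×-dec Vecₚ.≡-dec _≟_ (vsum (map E U)) k)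

  cover : ∀ U → IncrSet E d k U → U ∈ listsOver (upTo (B (lookup k c))) d
  cover U (_ , refl , refl) = ∈-listsOver (All.tabulate (λ m∈ → ∈-upTo⁺ (bounded _ _ (lookup-weight≤ E c U m∈))))

module _ (n : ℕ) .{{_ : NonZero n}} where

  -- Factors (k , i) are numbered by pos (k , i) = i + k·n, which lists them in
  -- lexicographic order.
  pos : ℕ × Fin n → ℕ
  pos (k , i) = toℕ i + k * n

  unpos : ℕ → ℕ × Fin n
  unpos m = m / n , m mod n

  unpos-pos : ∀ x → unpos (pos x) ≡ x
  unpos-pos (k , i) = cong₂ _,_
    (trans (+-distrib-/-∣ʳ (toℕ i) (n∣m*n k)) (cong₂ _+_ (m<n⇒m/n≡0 (toℕ<n i)) (m*n/n≡m k n)))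
    (toℕ-injective (trans (toℕ-fromℕ< _) (trans ([m+kn]%n≡m%n (toℕ i) k n) (m<n⇒m%n≡m (toℕ<n i)))))

  pos-unpos : ∀ m → pos (unpos m) ≡ m
  pos-unpos m = trans (cong (_+ m / n * n) (toℕ-fromℕ< (m%n<n m n))) (sym (m≡m%n+[m/n]*n m n))

  pos-< : ∀ {x y} → x <ₚ y → pos x < pos y
  pos-< {k , i} {k' , i'} (inj₁ k<k') = begin-strict
    toℕ i + k * n   <⟨ +-monoˡ-< (k * n) (toℕ<n i) ⟩
    suc k * n       ≤⟨ *-monoˡ-≤ n k<k' ⟩
    k' * n          ≤⟨ m≤n+m (k' * n) (toℕ i') ⟩
    toℕ i' + k' * n ∎
    where open ≤-Reasoning
  pos-< {k , i} (inj₂ (refl , i<i')) = +-monoˡ-< (k * n) i<i'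

  <-pos : ∀ {x y} → pos x < pos y → x <ₚ y
  <-pos {k , i} {k' , i'} lt with <-cmp k k'
  ... | tri< k<k' _ _ = inj₁ k<k'
  ... | tri≈ _ refl _ = inj₂ (refl , +-cancelʳ-< (k * n) (toℕ i) (toℕ i') lt)
  ... | tri> _ _ k'<k = ⊥-elim (<-asym lt (pos-< (inj₁ k'<k)))

  -- mirror reverses each block i + k·n (0 ≤ i < n) of consecutive numbers.
  mirror : ℕ → ℕ
  mirror m = pos (m / n , opposite (m mod n))

  unpos-mirror : ∀ m → unpos (mirror m) ≡ (m / n , opposite (m mod n))
  unpos-mirror m = unpos-pos (m / n , opposite (m mod n))

  mirror-involutive : ∀ m → mirror (mirror m) ≡ m
  mirror-involutive m = trans (cong (λ x → pos (proj₁ x , opposite (proj₂ x))) (unpos-mirror m))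
    (trans (cong (λ i → pos (m / n , i)) (opposite-involutive (m mod n))) (pos-unpos m))

  hasCard-coeff : ∀ (e : ℕ × Fin n → Vec ℕ n) d k {N} → HasCard (IncrSet (e ∘ unpos) d k) N → HasCard (Coeff e d k) N
  hasCard-coeff e d k =
    hasCard-bijection (map unpos) (map pos) toCoeff toIncr (λ {U} _ → posUnpos U) (λ {S} _ → unposPos S)
    where
    posUnpos : ∀ U → map pos (map unpos U) ≡ U
    posUnpos U = trans (sym (map-∘ U)) (trans (map-cong pos-unpos U) (map-id U))
    unposPos : ∀ S → map unpos (map pos S) ≡ S
    unposPos S = trans (sym (map-∘ S)) (trans (map-cong unpos-pos S) (map-id S))
    toCoeff : ∀ {U} → IncrSet (e ∘ unpos) d k U → Coeff e d k (map unpos U)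
    toCoeff {U} (inc , len , wt) =
      Linkedₚ.map⁺ (Linked.map (λ lt → <-pos (subst₂ _<_ (sym (pos-unpos _)) (sym (pos-unpos _)) lt)) inc) ,
      trans (length-map unpos U) len , trans (cong vsum (sym (map-∘ U))) wt
    toIncr : ∀ {S} → Coeff e d k S → IncrSet (e ∘ unpos) d k (map pos S)
    toIncr {S} (lin , len , wt) =
      Linkedₚ.map⁺ (Linked.map pos-< lin) , trans (length-map pos S) len ,
      trans (cong vsum (trans (map-∘ (map pos S)) (cong (map e) (unposPos S)))) wt

  coefficients : ∀ (e : ℕ × Fin n → Vec ℕ n) (c : Fin n) → (∀ {x y} → e x ≡ e y → x ≡ y) →
    (∀ k i → k ≤ lookup (e (k , i)) c) → (σ : ℕ → ℕ) → (∀ m → σ (σ m) ≡ m) →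
    (H : List (Vec ℕ n) → Set) → (∀ T → H T ⇔ (∃ λ W → Decreasing W × map (e ∘ unpos ∘ σ) W ≡ T)) →
    ∀ d k → Σ ℕ λ N → HasCard (PH H d k) N × HasCard (Coeff e d k) N
  coefficients e c e-inj bound σ σσ H frobenius d k with hasCard-incrSet (e ∘ unpos) c (λ K → suc K * n) bounded d k
    where
    bounded : ∀ m K → lookup (e (unpos m)) c ≤ K → m < suc K * n
    bounded m K le = begin-strict
      m                ≡⟨ m≡m%n+[m/n]*n m n ⟩
      m % n + m / n * n <⟨ +-monoˡ-< (m / n * n) (m%n<n m n) ⟩
      n + m / n * n     ≤⟨ +-monoʳ-≤ n (*-monoˡ-≤ n (≤-trans (bound (m / n) (m mod n)) le)) ⟩
      suc K * n         ∎
      where open ≤-Reasoning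
  ... | N , sets = N , hasCard-image (map E) E-inj onto (hasCard-relabel (e ∘ unpos) σ σσ d k sets) , hasCard-coeff e d k sets
    where
    E : ℕ → Vec ℕ n
    E = e ∘ unpos ∘ σ
    E-inj : ∀ {W W'} → DecrSet E d k W → DecrSet E d k W' → map E W ≡ map E W' → W ≡ W'
    E-inj _ _ = map-injective λ {m} {m'} eq →
      let σm≡σm' = trans (sym (pos-unpos (σ m))) (trans (cong pos (e-inj eq)) (pos-unpos (σ m'))) in
      trans (sym (σσ m)) (trans (cong σ σm≡σm') (σσ m'))
    onto : ∀ T → PH H d k T ⇔ (∃ λ W → DecrSet E d k W × map E W ≡ T)
    onto T = mk⇔
      (λ (inH , len , wt) → let (W , dec , WT) = Equivalence.to (frobenius T) inH in
        W , (dec , trans (sym (length-map E W)) (trans (cong length WT) len) , trans (cong vsum WT) wt) , WT)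
      (λ { (W , (dec , len , wt) , refl) → Equivalence.from (frobenius _) (W , dec , refl) , trans (length-map E W) len , wt })


-- Row t and column t of a diagram, counted from 0 (Defs counts from 1).
row col : List ℕ → ℕ → ℕ
row Y t = rowLen Y (suc t)
col Y t = colLen Y (suc t)

-- D is the side of the Durfee square of Y: the diagonal box (t+1,t+1) lies in Y
-- exactly when t < D.
IsDurfee : List ℕ → ℕ → Set
IsDurfee Y D = (∀ t → t < D → suc t ≤ row Y t) × (∀ t → D ≤ t → row Y t ≤ t)

arms legs : List ℕ → ℕ → List ℕ
arms Y D = applyUpTo (λ t → row Y t ∸ suc t) D
legs Y D = applyUpTo (λ t → col Y t ∸ suc t) D

row-beyond : ∀ Y t → length Y ≤ t → row Y t ≡ 0
row-beyond [] t _ = refl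
row-beyond (r ∷ rs) (suc t) (s≤s le) = row-beyond rs t le

row≤head : ∀ {r rs} → Linked _≥_ (r ∷ rs) → ∀ t → row (r ∷ rs) t ≤ r
row≤head _ zero = ≤-refl
row≤head {rs = []} _ (suc t) = z≤n
row≤head {rs = r' ∷ rs} (r≥r' ∷ l) (suc t) = ≤-trans (row≤head l t) r≥r'

row-antitone : ∀ {Y} → Linked _≥_ Y → ∀ {s t} → s ≤ t → row Y t ≤ row Y s
row-antitone {[]} _ _ = z≤n
row-antitone {r ∷ rs} l {zero} {t} _ = row≤head l t
row-antitone {r ∷ rs} l {suc s} {suc t} (s≤s s≤t) = row-antitone (Linked.tail l) s≤t

colLen-∷-≤ : ∀ {r rs c} → c ≤ r → colLen (r ∷ rs) c ≡ suc (colLen rs c)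
colLen-∷-≤ {r} {rs} {c} c≤r = cong length (filter-accept (c ≤?_) {r} {rs} c≤r)

colLen-∷-≰ : ∀ {r rs c} → ¬ c ≤ r → colLen (r ∷ rs) c ≡ colLen rs c
colLen-∷-≰ {r} {rs} {c} c≰r = cong length (filter-reject (c ≤?_) {r} {rs} c≰r)

colLen-antitone : ∀ Y c → colLen Y (suc c) ≤ colLen Y c
colLen-antitone [] c = z≤n
colLen-antitone (r ∷ rs) c with suc c ≤? r | c ≤? r
... | yes sc≤r | _ rewrite colLen-∷-≤ {r} {rs} sc≤r | colLen-∷-≤ {r} {rs} (<⇒≤ sc≤r) = s≤s (colLen-antitone rs c)
... | no sc≰r | yes c≤r rewrite colLen-∷-≰ {r} {rs} sc≰r | colLen-∷-≤ {r} {rs} c≤r = m≤n⇒m≤1+n (colLen-antitone rs c)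
... | no sc≰r | no c≰r rewrite colLen-∷-≰ {r} {rs} sc≰r | colLen-∷-≰ {r} {rs} c≰r = colLen-antitone rs c

colLen-reach : ∀ {Y} → Linked _≥_ Y → ∀ {c} s → 1 ≤ c → c ≤ row Y s → suc s ≤ colLen Y c
colLen-reach {[]} _ _ 1≤c c≤0 = ⊥-elim (1+n≰n (≤-trans 1≤c c≤0))
colLen-reach {r ∷ rs} l s 1≤c c≤row rewrite colLen-∷-≤ {r} {rs} (≤-trans c≤row (row≤head l s)) with s
... | zero = s≤s z≤n
... | suc s' = s≤s (colLen-reach (Linked.tail l) s' 1≤c c≤row)

firstFailure : ∀ {P : ℕ → Set} → Decidable P → ∀ L → ¬ P L → ∃ λ D → (∀ t → t < D → P t) × ¬ P D
firstFailure {P} P? L ¬PL with allBelowOrFirst L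
  where
  allBelowOrFirst : ∀ L → (∀ t → t < L → P t) ⊎ (∃ λ D → (∀ t → t < D → P t) × ¬ P D)
  allBelowOrFirst zero = inj₁ (λ t ())
  allBelowOrFirst (suc L) with allBelowOrFirst L | P? L
  ... | inj₂ first | _ = inj₂ first
  ... | inj₁ below | no ¬PL' = inj₂ (L , below , ¬PL')
  ... | inj₁ below | yes PL' = inj₁ λ t t<1+L → [ below t , (λ { refl → PL' }) ]′ (m<1+n⇒m<n∨m≡n t<1+L)
... | inj₁ below = L , below , ¬PL
... | inj₂ first = first

durfee : ∀ {Y} → YoungDiagram Y → ∃ (IsDurfee Y)
durfee {Y} (_ , l) with firstFailure (λ t → suc t ≤? row Y t) (length Y) outside
  where
  outside : ¬ (suc (length Y) ≤ row Y (length Y))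
  outside le = n≮0 (subst (length Y <_) (row-beyond Y (length Y) ≤-refl) le)
... | D , inside , ¬onD = D , inside , λ t D≤t → ≤-trans (row-antitone l D≤t) (≤-trans (≤-pred (≰⇒> ¬onD)) D≤t)

-- Each of the D diagonal boxes lies in a different row.
durfee≤length : ∀ Y {D} → IsDurfee Y D → D ≤ length Y
durfee≤length Y {zero} _ = z≤n
durfee≤length Y {suc D} (inside , _) with length Y ≤? D
... | yes L≤D = ⊥-elim (n≮0 (subst (D <_) (row-beyond Y D L≤D) (inside D ≤-refl)))
... | no L≰D = ≰⇒> L≰D

length-filter-threshold : ∀ {P : ℕ → Set} (P? : Decidable P) (f : ℕ → ℕ) L D → D ≤ L →
  (∀ t → t < D → P (f t)) → (∀ t → D ≤ t → ¬ P (f t)) → length (filter P? (applyUpTo f L)) ≡ D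
length-filter-threshold P? f zero zero _ _ _ = refl
length-filter-threshold P? f (suc L) zero _ below above =
  trans (cong length (filter-reject P? (above 0 z≤n)))
        (length-filter-threshold P? (f ∘ suc) L zero z≤n (λ t ()) (λ t _ → above (suc t) z≤n))
length-filter-threshold P? f (suc L) (suc D) (s≤s D≤L) below above =
  trans (cong length (filter-accept P? (below 0 (s≤s z≤n))))
        (cong suc (length-filter-threshold P? (f ∘ suc) L D D≤L (λ t t<D → below (suc t) (s≤s t<D))
                                                             (λ t D≤t → above (suc t) (s≤s D≤t))))

diagLen-durfee : ∀ Y {D} → IsDurfee Y D → diagLen Y ≡ D
diagLen-durfee Y {D} dur@(inside , outside) =
  trans (cong (length ∘ filter (λ t → t ≤? rowLen Y t)) (map-upTo suc (length Y)))
        (length-filter-threshold (λ t → t ≤? rowLen Y t) suc (length Y) D (durfee≤length Y dur)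
          inside (λ t D≤t → <⇒≱ (s≤s (outside t D≤t))))

linked-applyUpTo : ∀ {R : ℕ → ℕ → Set} (f : ℕ → ℕ) D →
  (∀ t → suc t < D → R (f t) (f (suc t))) → Linked R (applyUpTo f D)
linked-applyUpTo f zero _ = []
linked-applyUpTo f (suc zero) _ = [-]
linked-applyUpTo f (suc (suc D)) step =
  step 0 (s≤s (s≤s z≤n)) ∷ linked-applyUpTo (f ∘ suc) (suc D) (λ t lt → step (suc t) (s≤s lt))

-- Moving one step along the diagonal shortens a hook arm or leg strictly.
shorter : ∀ {s x' x} → suc s ≤ x' → x' ≤ x → x' ∸ suc s < x ∸ s
shorter {s} sx'≤ x'≤x = <-≤-trans (∸-monoʳ-< ≤-refl sx'≤) (∸-monoˡ-≤ s x'≤x)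

arms-decreasing : ∀ {Y D} → YoungDiagram Y → IsDurfee Y D → Decreasing (arms Y D)
arms-decreasing {Y} {D} (_ , l) (inside , _) = linked-applyUpTo _ D
  λ t st<D → shorter (inside (suc t) st<D) (row-antitone l (n≤1+n t))

legs-decreasing : ∀ {Y D} → YoungDiagram Y → IsDurfee Y D → Decreasing (legs Y D)
legs-decreasing {Y} {D} (_ , l) (inside , _) = linked-applyUpTo _ D
  λ t st<D → shorter (colLen-reach l (suc t) (s≤s z≤n) (inside (suc t) st<D)) (colLen-antitone Y (suc t))

applyUpTo-cong< : ∀ {A : Set} {f g : ℕ → A} D → (∀ t → t < D → f t ≡ g t) → applyUpTo f D ≡ applyUpTo g D
applyUpTo-cong< zero _ = refl
applyUpTo-cong< (suc D) eq = cong₂ _∷_ (eq 0 (s≤s z≤n)) (applyUpTo-cong< D (λ t t<D → eq (suc t) (s≤s t<D)))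

addHook : ℕ → List ℕ → ℕ → List ℕ
addHook A B k = A ∷ (map suc B ++ replicate k 1)

row-shifted : ∀ B zs t → t < length B → row (map suc B ++ zs) t ≡ suc (row B t)
row-shifted (b ∷ bs) zs zero _ = refl
row-shifted (b ∷ bs) zs (suc t) (s≤s t<) = row-shifted bs zs t t<

row-shifted≤ : ∀ B k t → row (map suc B ++ replicate k 1) t ≤ suc (row B t)
row-shifted≤ [] k t = rowOfOnes k t
  where
  rowOfOnes : ∀ k t → row (replicate k 1) t ≤ 1
  rowOfOnes zero t = z≤n
  rowOfOnes (suc k) zero = ≤-refl
  rowOfOnes (suc k) (suc t) = rowOfOnes k t
row-shifted≤ (b ∷ bs) k zero = ≤-refl
row-shifted≤ (b ∷ bs) k (suc t) = row-shifted≤ bs k t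

addHook-young : ∀ {A B} k → YoungDiagram B → suc (row B 0) ≤ A → YoungDiagram (addHook A B k)
addHook-young {A} {B} k (_ , l) le =
  (≤-trans (s≤s z≤n) le ∷ Allₚ.++⁺ (Allₚ.map⁺ (All.universal (λ _ → s≤s z≤n) B)) (Allₚ.replicate⁺ k ≤-refl)) ,
  below A (shifted k l) (≤-trans (row-shifted≤ B k 0) le)
  where
  ones : ∀ k → Linked _≥_ (replicate k 1)
  ones zero = []
  ones (suc zero) = [-]
  ones (suc (suc k)) = ≤-refl ∷ ones (suc k)

  shifted : ∀ {B} k → Linked _≥_ B → Linked _≥_ (map suc B ++ replicate k 1)
  shifted {[]} k _ = ones k
  shifted {b ∷ []} zero _ = [-]
  shifted {b ∷ []} (suc k) _ = s≤s z≤n ∷ ones (suc k)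
  shifted {b ∷ b' ∷ bs} k (b≥b' ∷ l) = s≤s b≥b' ∷ shifted k l

  below : ∀ x {ys} → Linked _≥_ ys → row ys 0 ≤ x → Linked _≥_ (x ∷ ys)
  below x {[]} _ _ = [-]
  below x {y ∷ ys} l y≤x = y≤x ∷ l

addHook-durfee : ∀ {A} B {D} k → IsDurfee B D → D ≤ length B → 1 ≤ A → IsDurfee (addHook A B k) (suc D)
addHook-durfee {A} B {D} k (inside , outside) D≤len 1≤A = inside' , outside'
  where
  inside' : ∀ t → t < suc D → suc t ≤ row (addHook A B k) t
  inside' zero _ = 1≤A
  inside' (suc t) (s≤s t<D) =
    subst (suc (suc t) ≤_) (sym (row-shifted B _ t (<-≤-trans t<D D≤len))) (s≤s (inside t t<D))
  outside' : ∀ t → suc D ≤ t → row (addHook A B k) t ≤ t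
  outside' (suc t) (s≤s D≤t) = ≤-trans (row-shifted≤ B k t) (s≤s (outside t D≤t))

addHook-arms : ∀ A B {D} k → D ≤ length B → arms (addHook A B k) (suc D) ≡ (A ∸ 1) ∷ arms B D
addHook-arms A B {D} k D≤len = cong ((A ∸ 1) ∷_) (applyUpTo-cong< D
  λ t t<D → cong (_∸ suc (suc t)) (row-shifted B _ t (<-≤-trans t<D D≤len)))

colLen-map-suc : ∀ B c → colLen (map suc B) (suc c) ≡ colLen B c
colLen-map-suc [] c = refl
colLen-map-suc (b ∷ bs) c with c ≤? b
... | yes c≤b = trans (colLen-∷-≤ {suc b} (s≤s c≤b)) (trans (cong suc (colLen-map-suc bs c)) (sym (colLen-∷-≤ c≤b)))
... | no c≰b = trans (colLen-∷-≰ {suc b} (c≰b ∘ ≤-pred)) (trans (colLen-map-suc bs c) (sym (colLen-∷-≰ c≰b)))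

colLen-ones : ∀ k c → colLen (replicate k 1) (suc (suc c)) ≡ 0
colLen-ones zero c = refl
colLen-ones (suc k) c = trans (colLen-∷-≰ {1} {replicate k 1} {suc (suc c)} (λ { (s≤s ()) })) (colLen-ones k c)

colLen-++ : ∀ xs ys c → colLen (xs ++ ys) c ≡ colLen xs c + colLen ys c
colLen-++ xs ys c = trans (cong length (filter-++ (c ≤?_) xs ys)) (length-++ (filter (c ≤?_) xs))

colLen-positive : ∀ {Y} → All (1 ≤_) Y → colLen Y 1 ≡ length Y
colLen-positive [] = refl
colLen-positive (p ∷ ps) = trans (colLen-∷-≤ p) (cong suc (colLen-positive ps))

length-addHook : ∀ A B k → length (addHook A B k) ≡ suc (length B + k)
length-addHook A B k = cong suc (trans (length-++ (map suc B)) (cong₂ _+_ (length-map suc B) (length-replicate k)))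

addHook-legs : ∀ B {D} k → YoungDiagram B → D ≤ row B 0 →
  legs (addHook (suc (row B 0)) B k) (suc D) ≡ (length B + k) ∷ legs B D
addHook-legs B {D} k young D≤row = cong₂ _∷_ firstLeg (applyUpTo-cong< D λ t t<D →
  cong (_∸ suc (suc t)) (begin
    colLen (addHook (suc (row B 0)) B k) (suc (suc t))
      ≡⟨ colLen-∷-≤ {rs = map suc B ++ replicate k 1} (s≤s (<-≤-trans t<D D≤row)) ⟩
    suc (colLen (map suc B ++ replicate k 1) (suc (suc t)))
      ≡⟨ cong suc (colLen-++ (map suc B) (replicate k 1) (suc (suc t))) ⟩
    suc (colLen (map suc B) (suc (suc t)) + colLen (replicate k 1) (suc (suc t)))
      ≡⟨ cong₂ (λ x y → suc (x + y)) (colLen-map-suc B (suc t)) (colLen-ones k t) ⟩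
    suc (colLen B (suc t) + 0)
      ≡⟨ cong suc (+-identityʳ _) ⟩
    suc (col B t) ∎))
  where
  open ≡-Reasoning
  firstLeg : col (addHook (suc (row B 0)) B k) 0 ∸ 1 ≡ length B + k
  firstLeg = cong (_∸ 1) (trans (colLen-positive (proj₁ (addHook-young k young ≤-refl))) (length-addHook (suc (row B 0)) B k))

-- The diagram with prescribed strictly decreasing arm lengths (and shortest legs).
fromArms : List ℕ → List ℕ
fromArms [] = []
fromArms (v ∷ vs) = addHook (suc v) (fromArms vs) 0

length-fromArms : ∀ V → length (fromArms V) ≡ length V
length-fromArms [] = refl
length-fromArms (v ∷ vs) = trans (length-addHook (suc v) (fromArms vs) 0) (cong suc (trans (+-identityʳ _) (length-fromArms vs)))

fromArms-young : ∀ {V} → Decreasing V → YoungDiagram (fromArms V)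
fromArms-young {[]} _ = [] , []
fromArms-young {v ∷ []} _ = addHook-young 0 ([] , []) (s≤s z≤n)
fromArms-young {v ∷ v' ∷ vs} (v>v' ∷ dec) = addHook-young 0 (fromArms-young dec) (s≤s v>v')

fromArms-durfee : ∀ V → IsDurfee (fromArms V) (length V)
fromArms-durfee [] = (λ t ()) , (λ t _ → z≤n)
fromArms-durfee (v ∷ vs) =
  addHook-durfee (fromArms vs) 0 (fromArms-durfee vs) (≤-reflexive (sym (length-fromArms vs))) (s≤s z≤n)

fromArms-arms : ∀ V → arms (fromArms V) (length V) ≡ V
fromArms-arms [] = refl
fromArms-arms (v ∷ vs) =
  trans (addHook-arms (suc v) (fromArms vs) 0 (≤-reflexive (sym (length-fromArms vs)))) (cong (v ∷_) (fromArms-arms vs))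

-- The diagram with prescribed strictly decreasing leg lengths (and shortest arms).
fromLegs : List ℕ → List ℕ
fromLegs [] = []
fromLegs (w ∷ ws) = addHook (suc (row B 0)) B (w ∸ length B)
  where B = fromLegs ws

fromLegs-young : ∀ W → YoungDiagram (fromLegs W)
fromLegs-young [] = [] , []
fromLegs-young (w ∷ ws) = addHook-young _ (fromLegs-young ws) ≤-refl

fromLegs-durfee : ∀ W → IsDurfee (fromLegs W) (length W)
fromLegs-durfee [] = (λ t ()) , (λ t _ → z≤n)
fromLegs-durfee (w ∷ ws) =
  addHook-durfee (fromLegs ws) _ (fromLegs-durfee ws) (durfee≤length (fromLegs ws) (fromLegs-durfee ws)) (s≤s z≤n)

fromLegs-rows≤ : ∀ {w ws} → Decreasing (w ∷ ws) → length (fromLegs ws) ≤ w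
fromLegs-rows≤ {ws = []} _ = z≤n
fromLegs-rows≤ {w} {w' ∷ ws} (w>w' ∷ dec) =
  subst (_≤ w) (sym (trans (length-addHook (suc (row (fromLegs ws) 0)) (fromLegs ws) _)
                           (cong suc (m+[n∸m]≡n (fromLegs-rows≤ dec))))) w>w'

fromLegs-firstRow : ∀ W → length W ≤ row (fromLegs W) 0
fromLegs-firstRow [] = z≤n
fromLegs-firstRow (w ∷ ws) = s≤s (fromLegs-firstRow ws)

-- The legs of fromLegs W are W: the new first leg is length B + (w ∸ length B) = w.
fromLegs-legs : ∀ {W} → Decreasing W → legs (fromLegs W) (length W) ≡ W
fromLegs-legs {[]} _ = refl
fromLegs-legs {w ∷ ws} dec =
  trans (addHook-legs (fromLegs ws) _ (fromLegs-young ws) (fromLegs-firstRow ws))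
        (cong₂ _∷_ (m+[n∸m]≡n (fromLegs-rows≤ dec)) (fromLegs-legs (Linked.tail dec)))

-- 𝟙 d is 1 if the decided proposition holds and 0 otherwise.  Note that
-- 𝟙 (x ≤? y) is definitionally the bit (if x ≤ᵇ y then 1 else 0) used in Defs.
𝟙 : {P : Set} → Dec P → ℕ
𝟙 d = if does d then 1 else 0

𝟙-yes : {P : Set} → P → (d : Dec P) → 𝟙 d ≡ 1
𝟙-yes p (yes _) = refl
𝟙-yes p (no ¬p) = ⊥-elim (¬p p)

𝟙-no : {P : Set} → ¬ P → (d : Dec P) → 𝟙 d ≡ 0
𝟙-no ¬p (yes p) = ⊥-elim (¬p p)
𝟙-no ¬p (no _) = refl

𝟙-⇔ : {P Q : Set} → P ⇔ Q → (p : Dec P) (q : Dec Q) → 𝟙 p ≡ 𝟙 q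
𝟙-⇔ P⇔Q (yes p) q = sym (𝟙-yes (Equivalence.to P⇔Q p) q)
𝟙-⇔ P⇔Q (no ¬p) q = sym (𝟙-no (¬p ∘ Equivalence.from P⇔Q) q)

count-∷ : ∀ f c x xs → count f c (x ∷ xs) ≡ 𝟙 (f x ≟ c) + count f c xs
count-∷ f c x xs with f x ℕ.≡ᵇ c
... | true = refl
... | false = refl

count-++ : ∀ f c xs ys → count f c (xs ++ ys) ≡ count f c xs + count f c ys
count-++ f c xs ys =
  trans (cong length (filter-++ (λ x → f x ≟ c) xs ys)) (length-++ (filter (λ x → f x ≟ c) xs))

count-cong : ∀ {f g c c'} xs → (∀ x → f x ≡ c ⇔ g x ≡ c') → count f c xs ≡ count g c' xs
count-cong [] _ = refl
count-cong {f} {g} {c} {c'} (x ∷ xs) f⇔g = begin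
  count f c (x ∷ xs)               ≡⟨ count-∷ f c x xs ⟩
  𝟙 (f x ≟ c) + count f c xs       ≡⟨ cong₂ _+_ (𝟙-⇔ (f⇔g x) (f x ≟ c) (g x ≟ c')) (count-cong xs f⇔g) ⟩
  𝟙 (g x ≟ c') + count g c' xs     ≡⟨ count-∷ g c' x xs ⟨
  count g c' (x ∷ xs)              ∎
  where open ≡-Reasoning

count-map : ∀ f g c xs → count f c (map g xs) ≡ count (f ∘ g) c xs
count-map f g c [] = refl
count-map f g c (x ∷ xs) with f (g x) ℕ.≡ᵇ c
... | true = cong suc (count-map f g c xs)
... | false = count-map f g c xs

applyUpTo-+ : ∀ {A : Set} (f : ℕ → A) m k → applyUpTo f (m + k) ≡ applyUpTo f m ++ applyUpTo (λ x → f (m + x)) k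
applyUpTo-+ f zero k = refl
applyUpTo-+ f (suc m) k = cong (f 0 ∷_) (applyUpTo-+ (f ∘ suc) m k)

module _ (n : ℕ) .{{_ : NonZero n}} where

  count-residue-block : ∀ {r} → r < n → ∀ s → s ≤ n → count (_% n) r (upTo s) ≡ 𝟙 (r <? s)
  count-residue-block {r} r<n zero _ = sym (𝟙-no (λ ()) (r <? 0))
  count-residue-block {r} r<n (suc s) s<n = begin
    count (_% n) r (upTo (suc s))                 ≡⟨ cong (count (_% n) r) (upTo-∷ʳ s) ⟨
    count (_% n) r (upTo s ++ [ s ])              ≡⟨ count-++ (_% n) r (upTo s) [ s ] ⟩
    count (_% n) r (upTo s) + count (_% n) r [ s ]
      ≡⟨ cong₂ _+_ (count-residue-block r<n s (<⇒≤ s<n)) (count-∷ (_% n) r s []) ⟩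
    𝟙 (r <? s) + (𝟙 (s % n ≟ r) + 0)
      ≡⟨ cong (λ b → 𝟙 (r <? s) + (b + 0)) (𝟙-⇔ (mk⇔ (trans (sym s%n≡s)) (trans s%n≡s)) (s % n ≟ r) (s ≟ r)) ⟩
    𝟙 (r <? s) + (𝟙 (s ≟ r) + 0)                 ≡⟨ newElement ⟩
    𝟙 (r <? suc s)                                ∎
    where
    open ≡-Reasoning
    s%n≡s : s % n ≡ s
    s%n≡s = m<n⇒m%n≡m s<n
    newElement : 𝟙 (r <? s) + (𝟙 (s ≟ r) + 0) ≡ 𝟙 (r <? suc s)
    newElement with <-cmp r s
    ... | tri< r<s r≢s _ rewrite 𝟙-yes r<s (r <? s) | 𝟙-no (r≢s ∘ sym) (s ≟ r) | 𝟙-yes (m<n⇒m<1+n r<s) (r <? suc s) = refl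
    ... | tri≈ r≮s refl _ rewrite 𝟙-no r≮s (r <? s) | 𝟙-yes refl (s ≟ s) | 𝟙-yes (n<1+n s) (r <? suc s) = refl
    ... | tri> r≮s r≢s s<r rewrite 𝟙-no r≮s (r <? s) | 𝟙-no (r≢s ∘ sym) (s ≟ r) | 𝟙-no (<⇒≱ s<r ∘ ≤-pred) (r <? suc s) = refl

  count-residue : ∀ {r} → r < n → ∀ q s → s ≤ n → count (_% n) r (upTo (q * n + s)) ≡ q + 𝟙 (r <? s)
  count-residue r<n zero s s≤n = count-residue-block r<n s s≤n
  count-residue {r} r<n (suc q) s s≤n = begin
    count (_% n) r (upTo (n + q * n + s))
      ≡⟨ cong (count (_% n) r ∘ upTo) (+-assoc n (q * n) s) ⟩
    count (_% n) r (upTo (n + (q * n + s)))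
      ≡⟨ cong (count (_% n) r) (applyUpTo-+ (λ x → x) n (q * n + s)) ⟩
    count (_% n) r (upTo n ++ applyUpTo (n +_) (q * n + s))
      ≡⟨ count-++ (_% n) r (upTo n) _ ⟩
    count (_% n) r (upTo n) + count (_% n) r (applyUpTo (n +_) (q * n + s))
      ≡⟨ cong₂ _+_ (count-residue-block r<n n ≤-refl) nextBlocks ⟩
    𝟙 (r <? n) + (q + 𝟙 (r <? s))
      ≡⟨ cong (_+ (q + 𝟙 (r <? s))) (𝟙-yes r<n (r <? n)) ⟩
    suc q + 𝟙 (r <? s) ∎
    where
    open ≡-Reasoning
    nextBlocks : count (_% n) r (applyUpTo (n +_) (q * n + s)) ≡ q + 𝟙 (r <? s)
    nextBlocks = begin
      count (_% n) r (applyUpTo (n +_) (q * n + s))      ≡⟨ cong (count (_% n) r) (map-upTo (n +_) (q * n + s)) ⟨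
      count (_% n) r (map (n +_) (upTo (q * n + s)))     ≡⟨ count-map (_% n) (n +_) r (upTo (q * n + s)) ⟩
      count ((_% n) ∘ (n +_)) r (upTo (q * n + s))
        ≡⟨ count-cong {c = r} (upTo (q * n + s)) (λ x → mk⇔ (trans (sym (periodic x))) (trans (periodic x))) ⟩
      count (_% n) r (upTo (q * n + s))                  ≡⟨ count-residue r<n q s s≤n ⟩
      q + 𝟙 (r <? s)                                     ∎
      where
      periodic : ∀ x → (n + x) % n ≡ x % n
      periodic x = trans (cong (_% n) (+-comm n x)) ([m+n]%n≡m%n x n)

  private
    negResidue : ℕ → ℕ
    negResidue zero = 0
    negResidue (suc r) = n ∸ suc r

  %ℕ-neg : ∀ m → -[1+ m ] %ℕ n ≡ negResidue (suc m % n)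
  %ℕ-neg m with suc m % n
  ... | zero = refl
  ... | suc r = refl

  %ℕ-+n : ∀ z → (z ℤ.+ ℤ.+ n) %ℕ n ≡ z %ℕ n
  %ℕ-+n (ℤ.+ m) = [m+n]%n≡m%n m n
  %ℕ-+n -[1+ m ] with <-cmp (suc m) n
  ... | tri< m<n _ _ = begin
    (n ℤ.⊖ suc m) %ℕ n        ≡⟨ cong (_%ℕ n) (ℤₚ.⊖-≥ (<⇒≤ m<n)) ⟩
    (n ∸ suc m) % n           ≡⟨ m<n⇒m%n≡m (∸-monoʳ-< {n} {suc m} {0} (s≤s z≤n) (<⇒≤ m<n)) ⟩
    n ∸ suc m                 ≡⟨ cong negResidue (m<n⇒m%n≡m m<n) ⟨
    negResidue (suc m % n)    ≡⟨ %ℕ-neg m ⟨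
    -[1+ m ] %ℕ n             ∎
    where open ≡-Reasoning
  ... | tri≈ _ refl _ = begin
    (suc m ℤ.⊖ suc m) %ℕ suc m  ≡⟨ cong (_%ℕ suc m) (ℤₚ.n⊖n≡0 (suc m)) ⟩
    0                           ≡⟨ cong negResidue (n%n≡0 (suc m)) ⟨
    negResidue (suc m % suc m)  ≡⟨ %ℕ-neg m ⟨
    -[1+ m ] %ℕ suc m           ∎
    where open ≡-Reasoning
  ... | tri> _ _ n<m = begin
    (n ℤ.⊖ suc m) %ℕ n                 ≡⟨ cong (_%ℕ n) (trans (ℤₚ.⊖-< n<m) (cong (ℤ.-_ ∘ ℤ.+_) (+-∸-assoc 1 n≤m))) ⟩
    -[1+ m ∸ n ] %ℕ n                  ≡⟨ %ℕ-neg (m ∸ n) ⟩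
    negResidue (suc (m ∸ n) % n)       ≡⟨ cong negResidue ([m+n]%n≡m%n (suc (m ∸ n)) n) ⟨
    negResidue ((suc (m ∸ n) + n) % n) ≡⟨ cong (λ x → negResidue (suc x % n)) (m∸n+n≡m n≤m) ⟩
    negResidue (suc m % n)             ≡⟨ %ℕ-neg m ⟨
    -[1+ m ] %ℕ n                      ∎
    where
    open ≡-Reasoning
    n≤m : n ≤ m
    n≤m = ≤-pred n<m

  %ℕ-shift : ∀ z q {m} → z ℤ.+ ℤ.+ (q * n) ≡ ℤ.+ m → z %ℕ n ≡ m % n
  %ℕ-shift z zero eq = cong (_%ℕ n) (trans (sym (ℤₚ.+-identityʳ z)) eq)
  %ℕ-shift z (suc q) eq = trans (sym (%ℕ-+n z)) (%ℕ-shift (z ℤ.+ ℤ.+ n) q (trans regroup eq))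
    where
    regroup : (z ℤ.+ ℤ.+ n) ℤ.+ ℤ.+ (q * n) ≡ z ℤ.+ ℤ.+ (n + q * n)
    regroup = trans (ℤₚ.+-assoc z (ℤ.+ n) (ℤ.+ (q * n))) (cong (λ w → z ℤ.+ w) (sym (ℤₚ.pos-+ n (q * n))))

private
  cancel-row : ∀ a s x → (a ℤ.- s) ℤ.+ (s ℤ.+ x) ≡ a ℤ.+ x
  cancel-row = solve-∀
  cancel-col : ∀ a s t → (a ℤ.- (s ℤ.+ t)) ℤ.+ s ≡ a ℤ.- t
  cancel-col = solve-∀
  cancel-wrap : ∀ a s p q → (a ℤ.- (s ℤ.+ q)) ℤ.+ ((s ℤ.+ p) ℤ.+ q) ≡ a ℤ.+ p
  cancel-wrap = solve-∀

module Colours (n : ℕ) .{{_ : NonZero n}} (a : Fin n) where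

  A : ℕ
  A = toℕ a

  A<n : A < n
  A<n = toℕ<n a

  -- offset c: the cyclic distance from colour a forward to colour c.
  offset : ℕ → ℕ
  offset c = (c + (n ∸ A)) % n

  offset<n : ∀ c → offset c < n
  offset<n c = m%n<n (c + (n ∸ A)) n

  -- The exponent vectors of Defs measure colours by their offset.
  offset-ℤ : ∀ c → (ℤ.+ c ℤ.- ℤ.+ A) %ℕ n ≡ offset c
  offset-ℤ c = %ℕ-shift n (ℤ.+ c ℤ.- ℤ.+ A) 1 (begin
    (ℤ.+ c ℤ.- ℤ.+ A) ℤ.+ ℤ.+ (n + 0)
      ≡⟨ cong (λ m → (ℤ.+ c ℤ.- ℤ.+ A) ℤ.+ ℤ.+ m) (trans (+-identityʳ n) (sym (m+[n∸m]≡n (<⇒≤ A<n)))) ⟩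
    (ℤ.+ c ℤ.- ℤ.+ A) ℤ.+ ℤ.+ (A + (n ∸ A))        ≡⟨ cong (λ w → (ℤ.+ c ℤ.- ℤ.+ A) ℤ.+ w) (ℤₚ.pos-+ A (n ∸ A)) ⟩
    (ℤ.+ c ℤ.- ℤ.+ A) ℤ.+ (ℤ.+ A ℤ.+ ℤ.+ (n ∸ A))   ≡⟨ cancel-row (ℤ.+ c) (ℤ.+ A) (ℤ.+ (n ∸ A)) ⟩
    ℤ.+ c ℤ.+ ℤ.+ (n ∸ A)                          ≡⟨ ℤₚ.pos-+ c (n ∸ A) ⟨
    ℤ.+ (c + (n ∸ A))                              ∎)
    where open ≡-Reasoning

  private
    %-absorbˡ : ∀ m p → (m % n + p) % n ≡ (m + p) % n
    %-absorbˡ m p = trans (%-distribˡ-+ (m % n) p n)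
      (trans (cong (λ u → (u + p % n) % n) (m%n%n≡m%n m n)) (sym (%-distribˡ-+ m p n)))

  rowColour : ∀ {c} x → c < n → (A + x) % n ≡ c ⇔ x % n ≡ offset c
  rowColour {c} x c<n = mk⇔ to from
    where
    open ≡-Reasoning
    to : (A + x) % n ≡ c → x % n ≡ offset c
    to eq = begin
      x % n                       ≡⟨ [m+n]%n≡m%n x n ⟨
      (x + n) % n                 ≡⟨ cong (λ m → (x + m) % n) (m+[n∸m]≡n (<⇒≤ A<n)) ⟨
      (x + (A + (n ∸ A))) % n     ≡⟨ cong (_% n) (trans (sym (+-assoc x A _)) (cong (_+ (n ∸ A)) (+-comm x A))) ⟩
      (A + x + (n ∸ A)) % n       ≡⟨ %-absorbˡ (A + x) (n ∸ A) ⟨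
      ((A + x) % n + (n ∸ A)) % n ≡⟨ cong (λ m → (m + (n ∸ A)) % n) eq ⟩
      offset c                    ∎
    from : x % n ≡ offset c → (A + x) % n ≡ c
    from eq = begin
      (A + x) % n                 ≡⟨ cong (_% n) (+-comm A x) ⟩
      (x + A) % n                 ≡⟨ %-absorbˡ x A ⟨
      (x % n + A) % n             ≡⟨ cong (λ m → (m + A) % n) eq ⟩
      (offset c + A) % n          ≡⟨ %-absorbˡ (c + (n ∸ A)) A ⟩
      (c + (n ∸ A) + A) % n       ≡⟨ cong (_% n) (trans (+-assoc c _ A) (cong (c +_) (m∸n+n≡m (<⇒≤ A<n)))) ⟩
      (c + n) % n                 ≡⟨ [m+n]%n≡m%n c n ⟩
      c % n                       ≡⟨ m<n⇒m%n≡m c<n ⟩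
      c                           ∎

  reflect : ∀ {r} → r < n → n ∸ suc (n ∸ suc r) ≡ r
  reflect {r} r<n = trans (cong (n ∸_) (sym (+-∸-assoc 1 r<n))) (m∸[m∸n]≡n (<⇒≤ r<n))

  reflect<n : ∀ r → n ∸ suc r < n
  reflect<n r = ≤-<-trans (∸-monoʳ-≤ n (s≤s z≤n)) (∸-monoʳ-< {n} {1} {0} (s≤s z≤n) (ℕ.>-nonZero⁻¹ n))

  -- Going down a column the colours run backwards.
  colResidue : ∀ x → (ℤ.+ A ℤ.- ℤ.+ suc x) %ℕ n ≡ (A + (n ∸ suc (x % n))) % n
  colResidue x = %ℕ-shift n (ℤ.+ A ℤ.- ℤ.+ suc x) (suc (x / n)) (begin
    (ℤ.+ A ℤ.- ℤ.+ suc x) ℤ.+ ℤ.+ (n + Q)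
      ≡⟨ cong₂ (λ u v → (ℤ.+ A ℤ.- ℤ.+ suc u) ℤ.+ ℤ.+ (v + Q)) (m≡m%n+[m/n]*n x n) (sym (m+[n∸m]≡n (m%n<n x n))) ⟩
    (ℤ.+ A ℤ.- ℤ.+ (suc r + Q)) ℤ.+ ℤ.+ ((suc r + p) + Q)
      ≡⟨ cong₂ (λ u v → (ℤ.+ A ℤ.- u) ℤ.+ v) (ℤₚ.pos-+ (suc r) Q)
               (trans (ℤₚ.pos-+ (suc r + p) Q) (cong (ℤ._+ ℤ.+ Q) (ℤₚ.pos-+ (suc r) p))) ⟩
    (ℤ.+ A ℤ.- (ℤ.+ suc r ℤ.+ ℤ.+ Q)) ℤ.+ ((ℤ.+ suc r ℤ.+ ℤ.+ p) ℤ.+ ℤ.+ Q)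
      ≡⟨ cancel-wrap (ℤ.+ A) (ℤ.+ suc r) (ℤ.+ p) (ℤ.+ Q) ⟩
    ℤ.+ A ℤ.+ ℤ.+ p
      ≡⟨ ℤₚ.pos-+ A p ⟨
    ℤ.+ (A + p) ∎)
    where
    open ≡-Reasoning
    r = x % n
    Q = x / n * n
    p = n ∸ suc r

  -- Box x steps below a diagonal box has colour c exactly when x ≡ n - 1 - offset c
  -- modulo n: the row criterion applied to the reflected position y = n - 1 - (x mod n).
  colColour : ∀ {c} x → c < n → (ℤ.+ A ℤ.- ℤ.+ suc x) %ℕ n ≡ c ⇔ x % n ≡ n ∸ suc (offset c)
  colColour {c} x c<n = mk⇔
    (λ eq → trans (sym (reflect (m%n<n x n)))
                  (cong (λ z → n ∸ suc z) (trans (sym y%n≡y) (Equivalence.to viaRow (trans (sym (colResidue x)) eq)))))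
    (λ eq → trans (colResidue x)
                  (Equivalence.from viaRow (trans y%n≡y (trans (cong (λ z → n ∸ suc z) eq) (reflect (offset<n c))))))
    where
    y = n ∸ suc (x % n)
    viaRow : (A + y) % n ≡ c ⇔ y % n ≡ offset c
    viaRow = rowColour y c<n
    y%n≡y : y % n ≡ y
    y%n≡y = m<n⇒m%n≡m (reflect<n (x % n))

  residue-row : ∀ s x → res n a s (s + x) ≡ (A + x) % n
  residue-row s x = cong (_%ℕ n) (begin
    (ℤ.+ A ℤ.- ℤ.+ s) ℤ.+ ℤ.+ (s + x)             ≡⟨ cong (λ w → (ℤ.+ A ℤ.- ℤ.+ s) ℤ.+ w) (ℤₚ.pos-+ s x) ⟩
    (ℤ.+ A ℤ.- ℤ.+ s) ℤ.+ (ℤ.+ s ℤ.+ ℤ.+ x)        ≡⟨ cancel-row (ℤ.+ A) (ℤ.+ s) (ℤ.+ x) ⟩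
    ℤ.+ A ℤ.+ ℤ.+ x                               ≡⟨ ℤₚ.pos-+ A x ⟨
    ℤ.+ (A + x)                                   ∎)
    where open ≡-Reasoning

  residue-col : ∀ s x → res n a (suc s + x) s ≡ (ℤ.+ A ℤ.- ℤ.+ suc x) %ℕ n
  residue-col s x = cong (_%ℕ n) (begin
    (ℤ.+ A ℤ.- ℤ.+ (suc s + x)) ℤ.+ ℤ.+ s
      ≡⟨ cong (λ w → (ℤ.+ A ℤ.- w) ℤ.+ ℤ.+ s) (trans (cong ℤ.+_ (sym (+-suc s x))) (ℤₚ.pos-+ s (suc x))) ⟩
    (ℤ.+ A ℤ.- (ℤ.+ s ℤ.+ ℤ.+ suc x)) ℤ.+ ℤ.+ s   ≡⟨ cancel-col (ℤ.+ A) (ℤ.+ s) (ℤ.+ suc x) ⟩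
    ℤ.+ A ℤ.- ℤ.+ suc x                           ∎)
    where open ≡-Reasoning

  -- The boxes of colour c among (s, s), ..., (s, s + m): one per full block of n boxes,
  -- plus one if c is reached in the last partial block.
  rowCount : ∀ s m {c} → c < n → count (res n a s) c (range s (s + m)) ≡ m / n + 𝟙 (offset c ≤? m % n)
  rowCount s m {c} c<n = begin
    count (res n a s) c (range s (s + m))
      ≡⟨ cong (λ L → count (res n a s) c (map (s +_) (upTo L))) (trans (cong (_∸ s) (sym (+-suc s m))) (m+n∸m≡n s (suc m))) ⟩
    count (res n a s) c (map (s +_) (upTo (suc m)))
      ≡⟨ count-map (res n a s) (s +_) c (upTo (suc m)) ⟩
    count (res n a s ∘ (s +_)) c (upTo (suc m))
      ≡⟨ count-cong {g = _% n} {c' = offset c} (upTo (suc m)) inRow ⟩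
    count (_% n) (offset c) (upTo (suc m))
      ≡⟨ cong (count (_% n) (offset c) ∘ upTo) blocks ⟩
    count (_% n) (offset c) (upTo (m / n * n + suc (m % n)))
      ≡⟨ count-residue n (offset<n c) (m / n) (suc (m % n)) (m%n<n m n) ⟩
    m / n + 𝟙 (offset c <? suc (m % n))
      ≡⟨ cong (m / n +_) (𝟙-⇔ (mk⇔ ≤-pred s≤s) (offset c <? suc (m % n)) (offset c ≤? m % n)) ⟩
    m / n + 𝟙 (offset c ≤? m % n) ∎
    where
    open ≡-Reasoning
    inRow : ∀ x → res n a s (s + x) ≡ c ⇔ x % n ≡ offset c
    inRow x = subst (λ v → v ≡ c ⇔ x % n ≡ offset c) (sym (residue-row s x)) (rowColour x c<n)
    blocks : suc m ≡ m / n * n + suc (m % n)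
    blocks = trans (cong suc (trans (m≡m%n+[m/n]*n m n) (+-comm (m % n) _))) (sym (+-suc _ (m % n)))

  colCount : ∀ s r {c} → c < n → let M = r ∸ s in
    count (λ i → res n a i s) c (range (suc s) r) ≡ M / n + (if offset c ≤ᵇ n ∸ suc (M % n) then 0 else 1)
  colCount s r {c} c<n = begin
    count (λ i → res n a i s) c (map (suc s +_) (upTo M))
      ≡⟨ count-map (λ i → res n a i s) (suc s +_) c (upTo M) ⟩
    count (λ x → res n a (suc s + x) s) c (upTo M)
      ≡⟨ count-cong {g = _% n} {c' = n ∸ suc (offset c)} (upTo M) inColumn ⟩
    count (_% n) (n ∸ suc (offset c)) (upTo M)
      ≡⟨ cong (count (_% n) (n ∸ suc (offset c)) ∘ upTo) (trans (m≡m%n+[m/n]*n M n) (+-comm (M % n) _)) ⟩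
    count (_% n) (n ∸ suc (offset c)) (upTo (M / n * n + M % n))
      ≡⟨ count-residue n (reflect<n (offset c)) (M / n) (M % n) (<⇒≤ (m%n<n M n)) ⟩
    M / n + 𝟙 (n ∸ suc (offset c) <? M % n)
      ≡⟨ cong (M / n +_) (𝟙-⇔ lateInBlock (n ∸ suc (offset c) <? M % n) (¬? (offset c ≤? n ∸ suc (M % n)))) ⟩
    M / n + 𝟙 (¬? (offset c ≤? n ∸ suc (M % n)))
      ≡⟨ cong (M / n +_) (not-bit (offset c ≤ᵇ n ∸ suc (M % n))) ⟨
    M / n + (if offset c ≤ᵇ n ∸ suc (M % n) then 0 else 1) ∎
    where
    open ≡-Reasoning
    M = r ∸ s
    inColumn : ∀ x → res n a (suc s + x) s ≡ c ⇔ x % n ≡ n ∸ suc (offset c)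
    inColumn x = subst (λ v → v ≡ c ⇔ x % n ≡ n ∸ suc (offset c)) (sym (residue-col s x)) (colColour x c<n)
    not-bit : ∀ b → (if b then 0 else 1) ≡ (if not b then 1 else 0)
    not-bit true = refl
    not-bit false = refl
    swap : ∀ {δ ρ} → δ < n → ρ < n → n ∸ suc δ < ρ → n ∸ suc ρ < δ
    swap {δ} {ρ} δ<n ρ<n lt = subst (n ∸ suc ρ <_) (reflect δ<n) (∸-monoʳ-< (s≤s lt) ρ<n)
    lateInBlock : n ∸ suc (offset c) < M % n ⇔ (¬ offset c ≤ n ∸ suc (M % n))
    lateInBlock = mk⇔ (λ lt → <⇒≱ (swap (offset<n c) (m%n<n M n) lt))
                      (λ nle → swap (m%n<n M n) (offset<n c) (≰⇒> nle))

  -- The exponent vectors expo1 and expo2 of Defs both have this shape: the factor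
  -- (k , i) contributes k to every colour plus a bit β telling whether the offset of the
  -- colour is at most i.
  exponentVector : (Bool → ℕ) → ℕ × Fin n → Vec ℕ n
  exponentVector β (k , i) = tabulate λ c → k + β (((ℤ.+ toℕ c ℤ.- ℤ.+ A) %ℕ n) ≤ᵇ toℕ i)

  fvec-arm : ∀ Y t → suc t ≤ rowLen Y (suc t) → let m = rowLen Y (suc t) ∸ suc t in
    fvec n a Y (suc t) ≡ expo1 n a (m / n , m mod n)
  fvec-arm Y t inside = Vecₚ.tabulate-cong λ c → begin
    count (res n a (suc t)) (toℕ c) (range (suc t) (rowLen Y (suc t)))
      ≡⟨ cong (count (res n a (suc t)) (toℕ c) ∘ range (suc t)) (m+[n∸m]≡n inside) ⟨
    count (res n a (suc t)) (toℕ c) (range (suc t) (suc t + m))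
      ≡⟨ rowCount (suc t) m (toℕ<n c) ⟩
    m / n + 𝟙 (offset (toℕ c) ≤? m % n)
      ≡⟨ cong₂ (λ δ r → m / n + (if δ ≤ᵇ r then 1 else 0)) (offset-ℤ (toℕ c)) (toℕ-fromℕ< (m%n<n m n)) ⟨
    m / n + (if ((ℤ.+ toℕ c ℤ.- ℤ.+ A) %ℕ n) ≤ᵇ toℕ (m mod n) then 1 else 0) ∎
    where
    open ≡-Reasoning
    m = rowLen Y (suc t) ∸ suc t

  gvec-leg : ∀ Y t → let M = colLen Y (suc t) ∸ suc t in
    gvec n a Y (suc t) ≡ expo2 n a (M / n , opposite (M mod n))
  gvec-leg Y t = Vecₚ.tabulate-cong λ c → begin
    count (λ i → res n a i (suc t)) (toℕ c) (range (suc (suc t)) (colLen Y (suc t)))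
      ≡⟨ colCount (suc t) (colLen Y (suc t)) (toℕ<n c) ⟩
    M / n + (if offset (toℕ c) ≤ᵇ n ∸ suc (M % n) then 0 else 1)
      ≡⟨ cong₂ (λ δ r → M / n + (if δ ≤ᵇ r then 0 else 1)) (offset-ℤ (toℕ c))
               (trans (opposite-prop (M mod n)) (cong (λ r → n ∸ suc r) (toℕ-fromℕ< (m%n<n M n)))) ⟨
    M / n + (if ((ℤ.+ toℕ c ℤ.- ℤ.+ A) %ℕ n) ≤ᵇ toℕ (opposite (M mod n)) then 0 else 1) ∎
    where
    open ≡-Reasoning
    M = colLen Y (suc t) ∸ suc t

  colourAt : ℕ → Fin n
  colourAt j = (A + j) mod n

  offset-colourAt : ∀ {j} → j < n → offset (toℕ (colourAt j)) ≡ j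
  offset-colourAt {j} j<n = trans (sym (Equivalence.to (rowColour j (toℕ<n (colourAt j))) (sym (toℕ-fromℕ< (m%n<n (A + j) n)))))
                                  (m<n⇒m%n≡m j<n)

  lookup-exponentVector : ∀ β k i {j} → j < n → lookup (exponentVector β (k , i)) (colourAt j) ≡ k + β (j ≤ᵇ toℕ i)
  lookup-exponentVector β k i {j} j<n = trans (Vecₚ.lookup∘tabulate _ (colourAt j))
    (cong (λ δ → k + β (δ ≤ᵇ toℕ i)) (trans (offset-ℤ (toℕ (colourAt j))) (offset-colourAt j<n)))

  exponentVector-bound : ∀ β k i → k ≤ lookup (exponentVector β (k , i)) a
  exponentVector-bound β k i = subst (k ≤_) (sym (Vecₚ.lookup∘tabulate _ a)) (m≤m+n k _)

  exponentVector-injective : ∀ β → β true ≢ β false → ∀ {x y} → exponentVector β x ≡ exponentVector β y → x ≡ y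
  exponentVector-injective β β-distinct {k , i} {k' , i'} eq = fromEntries λ j j<n →
    trans (sym (lookup-exponentVector β k i j<n)) (trans (cong (λ v → lookup v (colourAt j)) eq) (lookup-exponentVector β k' i' j<n))
    where
    bitsBelow : ∀ (i i' : Fin n) → (∀ j → j < n → β (j ≤ᵇ toℕ i) ≡ β (j ≤ᵇ toℕ i')) → toℕ i ≤ toℕ i'
    bitsBelow i i' sameBits
      with toℕ i ≤ᵇ toℕ i | ≤⇒≤ᵇ (≤-refl {toℕ i}) | toℕ i ≤ᵇ toℕ i' | ≤ᵇ⇒≤ (toℕ i) (toℕ i') | sameBits (toℕ i) (toℕ<n i)
    ... | true | _ | true | i≤i' | _ = i≤i' tt
    ... | true | _ | false | _ | bits = ⊥-elim (β-distinct bits)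

    fromEntries : ∀ {k i k' i'} → (∀ j → j < n → k + β (j ≤ᵇ toℕ i) ≡ k' + β (j ≤ᵇ toℕ i')) → (k , i) ≡ (k' , i')
    fromEntries {k} {i} {k'} {i'} entries with +-cancelʳ-≡ (β true) k k' (entries 0 (ℕ.>-nonZero⁻¹ n))
    ... | refl = cong (k ,_) (toℕ-injective (≤-antisym
      (bitsBelow i i' (λ j j<n → +-cancelˡ-≡ k _ _ (entries j j<n)))
      (bitsBelow i' i (λ j j<n → sym (+-cancelˡ-≡ k _ _ (entries j j<n))))))

module _ (n : ℕ) .{{_ : NonZero n}} (a : Fin n) where
  open Colours n a

  topRow-arms : ∀ Y {D} → IsDurfee Y D → topRow n a Y ≡ map (expo1 n a ∘ unpos n) (arms Y D)
  topRow-arms Y {D} dur@(inside , _) = begin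
    map (fvec n a Y) (map suc (upTo (diagLen Y)))       ≡⟨ cong (λ L → map (fvec n a Y) (map suc (upTo L))) (diagLen-durfee Y dur) ⟩
    map (fvec n a Y) (map suc (upTo D))                 ≡⟨ trans (sym (map-∘ (upTo D))) (map-upTo (fvec n a Y ∘ suc) D) ⟩
    applyUpTo (fvec n a Y ∘ suc) D                      ≡⟨ applyUpTo-cong< D (λ t t<D → fvec-arm Y t (inside t t<D)) ⟩
    applyUpTo (expo1 n a ∘ unpos n ∘ λ t → row Y t ∸ suc t) D ≡⟨ map-applyUpTo _ (expo1 n a ∘ unpos n) D ⟨
    map (expo1 n a ∘ unpos n) (arms Y D)                ∎
    where open ≡-Reasoning

  bottomRow-legs : ∀ Y {D} → IsDurfee Y D → bottomRow n a Y ≡ map (expo2 n a ∘ unpos n ∘ mirror n) (legs Y D)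
  bottomRow-legs Y {D} dur = begin
    map (gvec n a Y) (map suc (upTo (diagLen Y)))       ≡⟨ cong (λ L → map (gvec n a Y) (map suc (upTo L))) (diagLen-durfee Y dur) ⟩
    map (gvec n a Y) (map suc (upTo D))                 ≡⟨ trans (sym (map-∘ (upTo D))) (map-upTo (gvec n a Y ∘ suc) D) ⟩
    applyUpTo (gvec n a Y ∘ suc) D
      ≡⟨ applyUpTo-cong< D (λ t _ → trans (gvec-leg Y t) (cong (expo2 n a) (sym (unpos-mirror n _)))) ⟩
    applyUpTo (expo2 n a ∘ unpos n ∘ mirror n ∘ λ t → col Y t ∸ suc t) D ≡⟨ map-applyUpTo _ (expo2 n a ∘ unpos n ∘ mirror n) D ⟨
    map (expo2 n a ∘ unpos n ∘ mirror n) (legs Y D)     ∎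
    where open ≡-Reasoning

  topRows : ∀ T → InH1 n a T ⇔ (∃ λ V → Decreasing V × map (expo1 n a ∘ unpos n ∘ id) V ≡ T)
  topRows T = mk⇔
    (λ { (Y , young , refl) → let (D , dur) = durfee young in
           arms Y D , arms-decreasing young dur , sym (topRow-arms Y dur) })
    (λ { (V , dec , refl) → fromArms V , fromArms-young dec ,
           trans (topRow-arms (fromArms V) (fromArms-durfee V)) (cong (map _) (fromArms-arms V)) })

  bottomRows : ∀ T → InH2 n a T ⇔ (∃ λ W → Decreasing W × map (expo2 n a ∘ unpos n ∘ mirror n) W ≡ T)
  bottomRows T = mk⇔
    (λ { (Y , young , refl) → let (D , dur) = durfee young in
           legs Y D , legs-decreasing young dur , sym (bottomRow-legs Y dur) })
    (λ { (W , dec , refl) → fromLegs W , fromLegs-young W ,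
           trans (bottomRow-legs (fromLegs W) (fromLegs-durfee W)) (cong (map _) (fromLegs-legs dec)) })

-- Both products: factors are coloured by exponentVector with the bit patterns of expo1
-- and expo2; H₁ is described by arms (no relabelling), H₂ by legs relabelled by mirror.
mainTheorem5 : (n : ℕ) .{{_ : NonZero n}} → 2 ≤ n → (a : Fin n) →
    ((d : ℕ) (k : Vec ℕ n) → Σ ℕ λ N →
    HasCard (PH (InH1 n a) d k) N × HasCard (Coeff (expo1 n a) d k) N)
    ×
    ((d : ℕ) (k : Vec ℕ n) → Σ ℕ λ N →
    HasCard (PH (InH2 n a) d k) N × HasCard (Coeff (expo2 n a) d k) N)
mainTheorem5 n _ a =
  coefficients n (expo1 n a) a (exponentVector-injective bit₁ (λ ())) (exponentVector-bound bit₁)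
    id (λ _ → refl) (InH1 n a) (topRows n a) ,
  coefficients n (expo2 n a) a (exponentVector-injective bit₂ (λ ())) (exponentVector-bound bit₂)
    (mirror n) (mirror-involutive n) (InH2 n a) (bottomRows n a)
  where
  open Colours n a
  bit₁ bit₂ : Bool → ℕ
  bit₁ b = if b then 1 else 0
  bit₂ b = if b then 0 else 1
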